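{- Let $G_\sigma=(V,E;\sigma)$ be a signed graph. The sign-connected components of $G_\sigma$ are exactly the unbalanced connected components of $G_\sigma$ together with the single vertices (as one-vertex subgraphs) of the balanced connected components of $G_\sigma$. In particular, $G_\sigma$ is sign connected if and only if either $G_\sigma$ is connected and unbalanced, or $|V|=1$.
   Context: A signed graph $G_\sigma=(V,E;\sigma)$ consists of a finite undirected graph $G=(V,E)$, in which loops and multiple edges are allowed, together with a map $\sigma:E\to\{ -1,+1\}$. All cycles are elementary; a loop is a cycle of length 1. A chain is a walk $x,e_1,x_1,e_2,\dots,y$, not necessarily elementary. The sign of a cycle or of a chain is the product of the signs of its edges, each counted with multiplicity; it is called positive or negative accordingly. $G_\sigma$ is balanced if every cycle is positive. Two vertices $x,y$ are sign connected if $x=y$, or if there exist both a positive chain and a negative chain joining $x$ and $y$. This is an equivalence relation on $V$. The subgraphs of $G_\sigma$ induced by its equivalence classes are the sign-connected components of $G_\sigma$. $G_\sigma$ is sign connected if it has exactly one sign-connected component. -}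

module Defs where

open import Data.Nat using (ℕ; suc; _≥_)
open import Data.Fin using (Fin)
open import Data.Sign using (Sign; +; -; _*_)
open import Data.List using (List; []; _∷_; length)
open import Data.List.Relation.Unary.All using (All)
open import Data.List.Relation.Unary.Unique.Propositional using (Unique)
open import Data.Product using (Σ; ∃; _×_; _,_)
open import Data.Sum using (_⊎_)
open import Relation.Binary.PropositionalEquality using (_≡_)

-- A finite signed graph: vertices Fin n, edges Fin m (loops and multiple
-- edges allowed), each edge e has (unordered) endpoints src e, tgt e and a sign σ e.
record SignedGraph : Set where
  field
    n   : ℕ
    m   : ℕ
    src : Fin m → Fin n
    tgt : Fin m → Fin n
    σ   : Fin m → Sign

module _ (G : SignedGraph) where
  open SignedGraph G

  V : Set
  V = Fin n

  Joins : Fin m → V → V → Set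
  Joins e x y = (src e ≡ x × tgt e ≡ y) ⊎ (src e ≡ y × tgt e ≡ x)

  -- chains (walks, not necessarily elementary)
  data Chain : V → V → Set where
    []  : ∀ {x} → Chain x x
    step : ∀ {x y z} (e : Fin m) → Joins e x y → Chain y z → Chain x z

  chainSign : ∀ {x y} → Chain x y → Sign
  chainSign [] = +
  chainSign (step e _ w) = σ e * chainSign w

  chainEdges : ∀ {x y} → Chain x y → List (Fin m)
  chainEdges [] = []
  chainEdges (step e _ w) = e ∷ chainEdges w

  -- vertices x = x₀, x₁, …, x_{k-1} of a chain of length k (final vertex omitted)
  chainVerts : ∀ {x y} → Chain x y → List V
  chainVerts [] = []
  chainVerts {x} (step e _ w) = x ∷ chainVerts w

  -- an (elementary) cycle: a nonempty closed chain with pairwise distinct edges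
  -- and pairwise distinct vertices; a loop is a cycle of length 1
  record Cycle : Set where
    field
      base     : V
      walk     : Chain base base
      nonempty : length (chainEdges walk) ≥ 1
      edgesDistinct : Unique (chainEdges walk)
      vertsDistinct : Unique (chainVerts walk)

  cycleSign : Cycle → Sign
  cycleSign c = chainSign (Cycle.walk c)

  cycleVerts : Cycle → List V
  cycleVerts c = chainVerts (Cycle.walk c)

  -- balancedness of the subgraph induced by a vertex set P
  -- (its cycles are exactly the cycles of G all of whose vertices lie in P)
  BalancedOn : (V → Set) → Set
  BalancedOn P = (c : Cycle) → All P (cycleVerts c) → cycleSign c ≡ +

  UnbalancedOn : (V → Set) → Set
  UnbalancedOn P = Σ Cycle λ c → All P (cycleVerts c) × cycleSign c ≡ -

  Balanced : Set
  Balanced = (c : Cycle) → cycleSign c ≡ +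

  Unbalanced : Set
  Unbalanced = Σ Cycle λ c → cycleSign c ≡ -

  -- connectivity; the connected component of x is the vertex set Connected x
  Connected : V → V → Set
  Connected x y = Chain x y

  ConnectedGraph : Set
  ConnectedGraph = V × ((x y : V) → Connected x y)

  SignConnected : V → V → Set
  SignConnected x y =
    x ≡ y ⊎ ((Σ (Chain x y) λ w → chainSign w ≡ +) × (Σ (Chain x y) λ w → chainSign w ≡ -))

  -- exactly one sign-connected component: V nonempty and all vertices sign connected
  SignConnectedGraph : Set
  SignConnectedGraph = V × ((x y : V) → SignConnected x y)

-- The heart of the proof is a cycle-extraction lemma: every negative closed
-- chain at x contains a negative (elementary) cycle whose base is reachable
-- from x.  It is proved by induction on the length of the chain: either the
-- chain already has distinct vertices and distinct edges (and is a cycle),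
-- or it can be cut at a repeated vertex, or at an edge traversed forth and
-- back, into a nonempty closed sub-chain and the remaining closed chain; the
-- sign of the whole is the product of the two signs, so one of two shorter
-- closed chains is negative.
--
-- A positive and a negative
-- chain from x to y concatenate (one reversed) to a negative closed chain,
-- hence give a negative cycle in the component of x; so in a balanced
-- component only x itself is sign connected to x.  Conversely, if the
-- component of x contains a negative cycle, every chain x ⇝ y can take a
-- detour around it, which flips its sign; so in an unbalanced component
-- connected and sign connected coincide.

module Submission where

open import Defs
open import Data.Empty using (⊥-elim)
open import Data.Fin using (Fin; zero; suc; _≟_)
open import Data.List using (length)
open import Data.List.Relation.Unary.All using (All; []; _∷_; universal)
open import Data.List.Relation.Unary.AllPairs using ([]; _∷_)
open import Data.List.Relation.Unary.Unique.Propositional using (Unique)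
open import Data.Nat using (ℕ; zero; suc; _≤_; _<_; z≤n; s≤s; s≤s⁻¹) renaming (_+_ to _+ℕ_)
open import Data.Nat.Properties using (<-≤-trans; m<n⇒m<1+n; m≤m+n; m<m+n; m<n+m; +-monoʳ-<; n<1+n)
open import Data.Product using (Σ; ∃; _×_; _,_)
import Data.Product as Prod
open import Data.Sign using (Sign; +; -; _*_; opposite)
open import Data.Sign.Properties using (*-assoc; *-comm; *-identityʳ; s*s≡+; *-commutativeSemigroup)
open import Algebra.Properties.CommutativeSemigroup *-commutativeSemigroup using (x∙yz≈y∙xz)
open import Data.Sum using (_⊎_; inj₁; inj₂)
import Data.Sum as Sum
open import Function using (_∘_)
open import Function.Bundles using (_⇔_; mk⇔; Equivalence)
open import Relation.Binary.PropositionalEquality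
  using (_≡_; _≢_; refl; sym; trans; cong; cong₂; subst; module ≡-Reasoning)
open import Relation.Nullary using (yes; no)

open ≡-Reasoning

negative-factor : ∀ s t → s * t ≡ - → s ≡ - ⊎ t ≡ -
negative-factor - t _   = inj₁ refl
negative-factor + t s*t = inj₂ s*t

conjugate-sign : ∀ s t u → s * (t * (s * u)) ≡ t * u
conjugate-sign s t u = begin
  s * (t * (s * u)) ≡⟨ x∙yz≈y∙xz s t (s * u) ⟩
  t * (s * (s * u)) ≡⟨ cong (t *_) (sym (*-assoc s s u)) ⟩
  t * ((s * s) * u) ≡⟨ cong (λ r → t * (r * u)) (s*s≡+ s) ⟩
  t * u             ∎

Fin1-unique : ∀ {n} → n ≡ 1 → (a b : Fin n) → a ≡ b
Fin1-unique refl zero zero = refl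

single-or-another : ∀ {n} (v : Fin n) → n ≡ 1 ⊎ ∃ (v ≢_)
single-or-another {suc zero}    zero    = inj₁ refl
single-or-another {suc (suc _)} zero    = inj₂ (suc zero , λ ())
single-or-another               (suc v) = inj₂ (zero , λ ())

module _ (G : SignedGraph) where
  open SignedGraph G using (m; σ)

  private
    Ch : V G → V G → Set
    Ch = Chain G

    sgn : ∀ {x y} → Ch x y → Sign
    sgn = chainSign G

    len : ∀ {x y} → Ch x y → ℕ
    len w = length (chainEdges G w)

    variable
      a b c d x y z : V G

  infixr 5 _++_
  _++_ : Ch x y → Ch y z → Ch x z
  []         ++ w' = w'
  step e j w ++ w' = step e j (w ++ w')

  ++-assoc : (u : Ch a b) (v : Ch b c) (w : Ch c d) → (u ++ v) ++ w ≡ u ++ (v ++ w)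
  ++-assoc []           v w = refl
  ++-assoc (step e j u) v w = cong (step e j) (++-assoc u v w)

  len-++ : (u : Ch x y) (w : Ch y z) → len (u ++ w) ≡ len u +ℕ len w
  len-++ []           w = refl
  len-++ (step e j u) w = cong suc (len-++ u w)

  sgn-++ : (u : Ch x y) (w : Ch y z) → sgn (u ++ w) ≡ sgn u * sgn w
  sgn-++ []           w = refl
  sgn-++ (step e j u) w = trans (cong (σ e *_) (sgn-++ u w)) (sym (*-assoc (σ e) (sgn u) (sgn w)))

  joins-sym : ∀ {e} → Joins G e x y → Joins G e y x
  joins-sym (inj₁ p) = inj₂ p
  joins-sym (inj₂ p) = inj₁ p

  rev : Ch x y → Ch y x
  rev []           = []
  rev (step e j w) = rev w ++ step e (joins-sym j) []

  sgn-rev : (w : Ch x y) → sgn (rev w) ≡ sgn w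
  sgn-rev []           = refl
  sgn-rev (step e j w) = begin
    sgn (rev w ++ step e _ []) ≡⟨ sgn-++ (rev w) (step e _ []) ⟩
    sgn (rev w) * (σ e * +)    ≡⟨ cong₂ _*_ (sgn-rev w) (*-identityʳ (σ e)) ⟩
    sgn w * σ e                ≡⟨ *-comm (sgn w) (σ e) ⟩
    σ e * sgn w                ∎

  same-edge-endpoints : ∀ {e} → Joins G e a b → Joins G e c d → (a ≡ c × b ≡ d) ⊎ (a ≡ d × b ≡ c)
  same-edge-endpoints (inj₁ (p , q)) (inj₁ (r , s)) = inj₁ (trans (sym p) r , trans (sym q) s)
  same-edge-endpoints (inj₁ (p , q)) (inj₂ (r , s)) = inj₂ (trans (sym p) r , trans (sym q) s)
  same-edge-endpoints (inj₂ (p , q)) (inj₁ (r , s)) = inj₂ (trans (sym q) s , trans (sym p) r)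
  same-edge-endpoints (inj₂ (p , q)) (inj₂ (r , s)) = inj₁ (trans (sym q) s , trans (sym p) r)

  visited-reachable : Ch x b → (w : Ch b z) → All (Ch x) (chainVerts G w)
  visited-reachable p []           = []
  visited-reachable p (step e j w) = p ∷ visited-reachable (p ++ step e j []) w

  record Passage {y z} (P : V G → Fin m → Set) (w : Ch y z) : Set where
    constructor passage
    field
      {source target} : V G
      before : Ch y source
      edge   : Fin m
      joins  : Joins G edge source target
      after  : Ch target z
      holds  : P source edge
      split  : w ≡ before ++ step edge joins after

  passage-step : ∀ {P e} (j : Joins G e x y) {w : Ch y z} → Passage P w → Passage P (step e j w)
  passage-step j (passage A f k C p refl) = passage (step _ j A) f k C p refl

  find-vertex : (v : V G) (w : Ch y z) → Passage (λ s _ → s ≡ v) w ⊎ All (v ≢_) (chainVerts G w)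
  find-vertex v []                   = inj₂ []
  find-vertex v (step {x = a} e j w) with a ≟ v
  ... | yes a≡v = inj₁ (passage [] e j w a≡v refl)
  ... | no  a≢v = Sum.map (passage-step j) ((a≢v ∘ sym) ∷_) (find-vertex v w)

  find-edge : (f : Fin m) (w : Ch y z) → Passage (λ _ g → g ≡ f) w ⊎ All (f ≢_) (chainEdges G w)
  find-edge f []           = inj₂ []
  find-edge f (step e j w) with e ≟ f
  ... | yes e≡f = inj₁ (passage [] e j w e≡f refl)
  ... | no  e≢f = Sum.map (passage-step j) ((e≢f ∘ sym) ∷_) (find-edge f w)

  record Shortcut {x y} (w : Ch x y) : Set where
    constructor shortcut
    field
      {junction centre} : V G
      before         : Ch x junction
      loop           : Ch junction junction
      after          : Ch junction y
      split          : w ≡ before ++ (loop ++ after)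
      loop-nonempty  : 1 ≤ len loop
      path           : Ch junction centre
      core           : Ch centre centre
      core-sign      : sgn core ≡ sgn loop
      core-shorter   : len core < len w

  shortcut-step : ∀ {e} (j : Joins G e x y) {w : Ch y z} → Shortcut w → Shortcut (step e j w)
  shortcut-step j (shortcut A M B refl M≥1 P N N≡M N<w) =
    shortcut (step _ j A) M B refl M≥1 P N N≡M (m<n⇒m<1+n N<w)

  -- A chain returning to its first vertex: the returning prefix is the loop.
  returning-shortcut : ∀ {e f} (j : Joins G e a b) (A : Ch b a) (k : Joins G f a c) (C : Ch c z)
                     → Shortcut (step e j (A ++ step f k C))
  returning-shortcut j A k C = shortcut [] (step _ j A) (step _ k C) refl (s≤s z≤n) [] (step _ j A) refl
    (s≤s (subst (len A <_) (sym (len-++ A (step _ k C))) (m<m+n (len A) (s≤s z≤n))))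

  -- A chain going back along its first edge: the loop is A framed by that edge
  -- in both directions, and its core is A.
  backtrack-shortcut : ∀ {e} (j : Joins G e a b) (A : Ch b b) (k : Joins G e b a) (C : Ch a z)
                     → Shortcut (step e j (A ++ step e k C))
  backtrack-shortcut {e = e} j A k C =
    shortcut [] (step e j (A ++ step e k [])) C (cong (step e j) (sym (++-assoc A (step e k []) C)))
      (s≤s z≤n) (step e j []) A (sym loop-sign)
      (s≤s (subst (len A ≤_) (sym (len-++ A (step e k C))) (m≤m+n (len A) _)))
    where
      loop-sign : σ e * sgn (A ++ step e k []) ≡ sgn A
      loop-sign = begin
        σ e * sgn (A ++ step e k []) ≡⟨ cong (σ e *_) (sgn-++ A (step e k [])) ⟩
        σ e * (sgn A * (σ e * +))    ≡⟨ conjugate-sign (σ e) (sgn A) + ⟩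
        sgn A * +                    ≡⟨ *-identityʳ (sgn A) ⟩
        sgn A                        ∎

  reused-edge-shortcut : ∀ {e} (j : Joins G e a b) (A : Ch b c) (k : Joins G e c d) (C : Ch d z)
                       → Shortcut (step e j (A ++ step e k C))
  reused-edge-shortcut j A k C with same-edge-endpoints j k
  ... | inj₁ (refl , refl) = returning-shortcut j A k C
  ... | inj₂ (refl , refl) = backtrack-shortcut j A k C

  analyse : (w : Ch x y) → Shortcut w ⊎ (Unique (chainVerts G w) × Unique (chainEdges G w))
  analyse []                   = inj₂ ([] , [])
  analyse (step {x = a} e j w) with find-vertex a w
  ... | inj₁ (passage A _ k C refl refl) = inj₁ (returning-shortcut j A k C)
  ... | inj₂ a∉w with find-edge e w
  ... | inj₁ (passage A _ k C refl refl) = inj₁ (reused-edge-shortcut j A k C)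
  ... | inj₂ e∉w = Sum.map (shortcut-step j) (Prod.map (a∉w ∷_) (e∉w ∷_)) (analyse w)

  record ShorterNegative {x} (w : Ch x x) : Set where
    constructor shorter-negative
    field
      {centre}  : V G
      path      : Ch x centre
      core      : Ch centre centre
      shorter   : len core < len w
      negative  : sgn core ≡ -

  loop-sign-split : (A : Ch x a) (M : Ch a a) (B : Ch a y) → sgn (A ++ (M ++ B)) ≡ sgn M * sgn (A ++ B)
  loop-sign-split A M B = begin
    sgn (A ++ (M ++ B))     ≡⟨ trans (sgn-++ A (M ++ B)) (cong (sgn A *_) (sgn-++ M B)) ⟩
    sgn A * (sgn M * sgn B) ≡⟨ x∙yz≈y∙xz (sgn A) (sgn M) (sgn B) ⟩
    sgn M * (sgn A * sgn B) ≡⟨ cong (sgn M *_) (sym (sgn-++ A B)) ⟩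
    sgn M * sgn (A ++ B)    ∎

  loop-removal-shorter : (A : Ch x a) (M : Ch a a) (B : Ch a y) → 1 ≤ len M
                       → len (A ++ B) < len (A ++ (M ++ B))
  loop-removal-shorter A M B M≥1 rewrite len-++ A B | len-++ A (M ++ B) | len-++ M B =
    +-monoʳ-< (len A) (m<n+m (len B) M≥1)

  -- In a negative closed chain, either the loop of a shortcut is negative
  -- (and then so is its core) or the chain without the loop is.
  shortcut-negative : {w : Ch x x} → Shortcut w → sgn w ≡ - → ShorterNegative w
  shortcut-negative (shortcut A M B refl M≥1 P N N≡M N<w) w⁻
    with negative-factor (sgn M) (sgn (A ++ B)) (trans (sym (loop-sign-split A M B)) w⁻)
  ... | inj₁ M⁻  = shorter-negative (A ++ P) N N<w (trans N≡M M⁻)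
  ... | inj₂ AB⁻ = shorter-negative [] (A ++ B) (loop-removal-shorter A M B M≥1) AB⁻

  NegativeCycleFrom : V G → Set
  NegativeCycleFrom x = Σ (Cycle G) λ γ → Ch x (Cycle.base γ) × cycleSign G γ ≡ -

  chain-cycle : (w : Ch x x) → sgn w ≡ - → Unique (chainVerts G w) → Unique (chainEdges G w)
              → NegativeCycleFrom x
  chain-cycle []           ()  _  _
  chain-cycle (step e j w) w⁻ uv ue =
    record { base = _ ; walk = step e j w ; nonempty = s≤s z≤n ; edgesDistinct = ue ; vertsDistinct = uv }
    , [] , w⁻

  negative-cycle-within : ∀ k (w : Ch x x) → len w < k → sgn w ≡ - → NegativeCycleFrom x
  negative-cycle-within zero    w ()  _
  negative-cycle-within (suc k) w w<k w⁻ with analyse w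
  ... | inj₂ (uv , ue) = chain-cycle w w⁻ uv ue
  ... | inj₁ s with shortcut-negative s w⁻
  ... | shorter-negative P N N<w N⁻ with negative-cycle-within k N (<-≤-trans N<w (s≤s⁻¹ w<k)) N⁻
  ... | γ , Q , γ⁻ = γ , P ++ Q , γ⁻

  negative-cycle : (w : Ch x x) → sgn w ≡ - → NegativeCycleFrom x
  negative-cycle w = negative-cycle-within (suc (len w)) w (n<1+n (len w))

  opposite-chains-cycle : (p q : Ch x y) → sgn p ≡ + → sgn q ≡ - → NegativeCycleFrom x
  opposite-chains-cycle p q p⁺ q⁻ = negative-cycle (p ++ rev q) (begin
    sgn (p ++ rev q)     ≡⟨ sgn-++ p (rev q) ⟩
    sgn p * sgn (rev q)  ≡⟨ cong₂ _*_ p⁺ (trans (sgn-rev q) q⁻) ⟩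
    -                    ∎)

  detour : Ch x b → Ch b b → Ch x y → Ch x y
  detour q C w = q ++ (C ++ (rev q ++ w))

  detour-sign : (q : Ch x b) (C : Ch b b) (w : Ch x y) → sgn (detour q C w) ≡ sgn C * sgn w
  detour-sign q C w = begin
    sgn (q ++ (C ++ (rev q ++ w)))     ≡⟨ sgn-++ q (C ++ (rev q ++ w)) ⟩
    sgn q * sgn (C ++ (rev q ++ w))    ≡⟨ cong (sgn q *_) (sgn-++ C (rev q ++ w)) ⟩
    sgn q * (sgn C * sgn (rev q ++ w)) ≡⟨ cong (λ r → sgn q * (sgn C * r)) (sgn-++ (rev q) w) ⟩
    sgn q * (sgn C * (sgn (rev q) * sgn w)) ≡⟨ cong (λ r → sgn q * (sgn C * (r * sgn w))) (sgn-rev q) ⟩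
    sgn q * (sgn C * (sgn q * sgn w))  ≡⟨ conjugate-sign (sgn q) (sgn C) (sgn w) ⟩
    sgn C * sgn w                      ∎

  opposite-signs : (w w' : Ch x y) → sgn w' ≡ opposite (sgn w) → SignConnected G x y
  opposite-signs w w' w'≡ with sgn w in w≡
  ... | + = inj₂ ((w , w≡) , (w' , w'≡))
  ... | - = inj₂ ((w' , w'≡) , (w , w≡))

  sign-connected-chain : SignConnected G x y → Ch x y
  sign-connected-chain (inj₁ refl)           = []
  sign-connected-chain (inj₂ ((p , _) , _)) = p

  base-visited : ∀ {P : V G → Set} (γ : Cycle G) → All P (cycleVerts G γ) → P (Cycle.base γ)
  base-visited record { walk = []         ; nonempty = () }
  base-visited record { walk = step _ _ _ } (p ∷ _) = p

  unbalanced-component : (x : V G) → UnbalancedOn G (Connected G x)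
                       → (y : V G) → SignConnected G x y ⇔ Connected G x y
  unbalanced-component x (γ , γ-in , γ⁻) y = mk⇔ sign-connected-chain λ w →
    opposite-signs w (detour q C w) (trans (detour-sign q C w) (cong (_* sgn w) γ⁻))
    where
      C = Cycle.walk γ
      q = base-visited γ γ-in

  balanced-component : (x : V G) → BalancedOn G (Connected G x)
                     → (y : V G) → SignConnected G x y ⇔ x ≡ y
  balanced-component x balanced y = mk⇔ only-itself inj₁
    where
      only-itself : SignConnected G x y → x ≡ y
      only-itself (inj₁ x≡y) = x≡y
      only-itself (inj₂ ((p , p⁺) , (q , q⁻))) with opposite-chains-cycle p q p⁺ q⁻
      ... | γ , r , γ⁻ with trans (sym (balanced γ (visited-reachable r (Cycle.walk γ)))) γ⁻
      ... | ()

  sign-connected-graph : SignConnectedGraph G ⇔ ((ConnectedGraph G × Unbalanced G) ⊎ SignedGraph.n G ≡ 1)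
  sign-connected-graph = mk⇔ to from
    where
      to : SignConnectedGraph G → (ConnectedGraph G × Unbalanced G) ⊎ SignedGraph.n G ≡ 1
      to (v , sc) with single-or-another v
      ... | inj₁ n≡1      = inj₂ n≡1
      ... | inj₂ (y , v≢y) with sc v y
      ... | inj₁ v≡y = ⊥-elim (v≢y v≡y)
      ... | inj₂ ((p , p⁺) , (q , q⁻)) with opposite-chains-cycle p q p⁺ q⁻
      ... | γ , _ , γ⁻ = inj₁ ((v , λ a b → sign-connected-chain (sc a b)) , (γ , γ⁻))

      from : (ConnectedGraph G × Unbalanced G) ⊎ SignedGraph.n G ≡ 1 → SignConnectedGraph G
      from (inj₁ ((v , conn) , (γ , γ⁻))) = v , λ a b →
        Equivalence.from (unbalanced-component a (γ , universal (conn a) _ , γ⁻) b) (conn a b)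
      from (inj₂ n≡1) = subst Fin (sym n≡1) zero , λ a b → inj₁ (Fin1-unique n≡1 a b)

theorem3p3 : (G : SignedGraph)
    → ((x : V G)
        → (UnbalancedOn G (Connected G x) → (y : V G) → SignConnected G x y ⇔ Connected G x y)
        × (BalancedOn G (Connected G x) → (y : V G) → SignConnected G x y ⇔ x ≡ y))
    × (SignConnectedGraph G ⇔ ((ConnectedGraph G × Unbalanced G) ⊎ SignedGraph.n G ≡ 1))
theorem3p3 G = (λ x → unbalanced-component G x , balanced-component G x) , sign-connected-graph G
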